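{- Let $q$ be a power of a prime, let $N$ be a positive integer with $N \mid q-1$, let $f : \mathbb{Z}_N \to \mathbb{F}_q$, and let $\zeta_N$ be a primitive $N$-th root of unity in $\mathbb{F}_q^*$. Then the least period of $\mathcal{F}_{\zeta_N}[f]$ and the least period of $\mathcal{F}_{\zeta_N}^{ -1}[f]$ are both equal to $N/\gcd(N, \operatorname{supp}(f))$.
   Context: $\mathbb{Z}_N = \mathbb{Z}/N\mathbb{Z}$, whose elements are identified with their canonical representatives in $\{0,1,\dots,N-1\}$. The DFT is $\mathcal{F}_{\zeta_N}[f](i) = \sum_{j\in\mathbb{Z}_N} f(j)\zeta_N^{ij}$, and $\mathcal{F}_{\zeta_N}^{ -1}[f] = N^{ -1}\mathcal{F}_{\zeta_N^{ -1}}[f]$. $\operatorname{supp}(f) = \{j \in \mathbb{Z}_N : f(j)\neq 0\}$, and for a finite set $A=\{a_1,\dots,a_s\}$ of integers, $\gcd(N, A) := \gcd(N, a_1, \dots, a_s)$ (using canonical representatives). A function $g$ on $\mathbb{Z}_N$ has least period $r$ if $r$ is the smallest positive integer with $g(i+\bar r) = g(i)$ for all $i \in \mathbb{Z}_N$. -}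

module Defs where

open import Level using (Level; _⊔_)
open import Algebra.Bundles using (CommutativeRing)
open import Data.Nat using (ℕ; zero; suc; _<_; _≤_; _^_; NonZero)
import Data.Nat as ℕ
open import Data.Nat.Divisibility using (_∣_)
open import Data.Nat.Primality using (Prime)
open import Data.Nat.DivMod using (_mod_)
open import Data.Fin using (Fin; toℕ)
open import Data.Product using (Σ; ∃; _×_)
open import Relation.Nullary using (¬_)
open import Relation.Binary.PropositionalEquality using (_≡_)

IsPrimePower : ℕ → Set
IsPrimePower q = Σ ℕ λ p → Σ ℕ λ k → Prime p × 1 ≤ k × q ≡ p ^ k

module _ {c ℓ : Level} (R : CommutativeRing c ℓ) where
  open CommutativeRing R

  record IsFiniteFieldOfOrder (q : ℕ) : Set (c ⊔ ℓ) where
    field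
      0≉1      : ¬ (0# ≈ 1#)
      inverse  : ∀ x → ¬ (x ≈ 0#) → ∃ λ y → x * y ≈ 1#
      enum     : Fin q → Carrier
      enum-surj : ∀ x → ∃ λ i → enum i ≈ x
      enum-inj  : ∀ i j → enum i ≈ enum j → i ≡ j

  pow : Carrier → ℕ → Carrier
  pow x zero    = 1#
  pow x (suc n) = x * pow x n

  embed : ℕ → Carrier
  embed zero    = 0#
  embed (suc n) = 1# + embed n

  IsPrimitiveRoot : ℕ → Carrier → Set ℓ
  IsPrimitiveRoot N ζ = pow ζ N ≈ 1# × (∀ k → 0 < k → k < N → ¬ (pow ζ k ≈ 1#))

  sumFin : ∀ {n} → (Fin n → Carrier) → Carrier
  sumFin {zero}  g = 0#
  sumFin {suc n} g = g Fin.zero + sumFin (λ j → g (Fin.suc j))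
    where import Data.Fin as Fin

  DFT : ∀ {N} → Carrier → (Fin N → Carrier) → Fin N → Carrier
  DFT ζ f i = sumFin (λ j → f j * pow ζ (toℕ i ℕ.* toℕ j))

  -- inverse DFT: F^{-1}_ζ[f] = N^{-1} F_{ζ^{-1}}[f], where Ninv is the
  -- inverse of N·1 in R and ζinv the inverse of ζ (both unique).
  invDFT : ∀ {N} → (Ninv ζinv : Carrier) → (Fin N → Carrier) → Fin N → Carrier
  invDFT Ninv ζinv f i = Ninv * DFT ζinv f i

  IsPeriod : ∀ N .{{_ : NonZero N}} → (Fin N → Carrier) → ℕ → Set ℓ
  IsPeriod N g r = ∀ i → g ((toℕ i ℕ.+ r) mod N) ≈ g i

  IsLeastPeriod : ∀ N .{{_ : NonZero N}} → (Fin N → Carrier) → ℕ → Set ℓ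
  IsLeastPeriod N g r =
    0 < r × IsPeriod N g r × (∀ s → 0 < s → IsPeriod N g s → r ≤ s)

  IsGcdSupp : ∀ N → (Fin N → Carrier) → ℕ → Set ℓ
  IsGcdSupp N f d =
    d ∣ N × (∀ j → ¬ (f j ≈ 0#) → d ∣ toℕ j) ×
    (∀ e → e ∣ N → (∀ j → ¬ (f j ≈ 0#) → e ∣ toℕ j) → e ∣ d)

{-# OPTIONS --safe #-}
-- Multiplying f pointwise by ζ^{r j} translates F_ζ[f] by r, so r is a period of F_ζ[f]
-- exactly when f and j ↦ f(j) ζ^{r j} have the same transform. The DFT is injective
-- (Σ_i ζ^{-ik} F_ζ[g](i) = N g(k), by orthogonality of the characters i ↦ ζ^{i m}), hence
-- r is a period iff ζ^{r j} = 1, i.e. N ∣ r j, for every j ∈ supp f; the least such r > 0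
-- is N / gcd(N, supp f). Finally F^{-1}_ζ[f] is a unit multiple of F_{ζ^{-1}}[f], and
-- ζ^{-1} is again a primitive N-th root of unity.
module Submission where

open import Defs
open import Level using (Level)
open import Algebra.Bundles using (CommutativeRing)
open import Data.Nat using (ℕ; _∸_; NonZero)
open import Data.Nat.Divisibility using (_∣_)
open import Data.Nat.DivMod using (_/_)
open import Data.Fin using (Fin)
open import Data.Product using (_×_)

open import Data.Nat using (zero; suc; _<_; z<s; ≢-nonZero; ≢-nonZero⁻¹; >-nonZero)
open import Data.Nat.Divisibility using (divides; ∣⇒≤; ∣-refl; ∣-trans)
open import Data.Nat.DivMod using (_%_; _mod_; m/n*n≡m; m≥n⇒m/n>0)
open import Data.Fin using (toℕ)
open import Data.Product using (_,_; proj₁; proj₂; ∃; curry; uncurry)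
open import Data.Empty using (⊥-elim)
open import Function using (_∘_; _⇔_; mk⇔; Equivalence)
open import Relation.Nullary using (¬_; yes; no)
open import Relation.Nullary.Decidable using (map′)
open import Relation.Binary.Definitions using (Decidable)
import Relation.Binary.PropositionalEquality as ≡
open ≡ using (_≡_)

module _ where
  open import Data.Nat using (_+_; _*_)
  open import Data.Nat.Properties
  open import Data.Nat.Divisibility using (*-monoʳ-∣; m/n∣m; m∣n*o⇒m/n∣o; m/n∣o⇒m∣o*n)
  open import Data.Nat.GCD using (gcd; gcd[m,n]∣m; gcd[m,n]∣n; gcd[m,n]≢0)
  open import Data.Nat.Coprimality using (coprime-/gcd; coprime-divisor)
  open import Data.Sum using (inj₁)
  open ≡.≡-Reasoning

  n∣m+[n∸o]⇒m≡o : ∀ {m n o} → m < n → o < n → n ∣ m + (n ∸ o) → m ≡ o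
  n∣m+[n∸o]⇒m≡o {m} {n} {o} m<n o<n (divides zero eq) =
    ⊥-elim (<⇒≢ (<-≤-trans (m<n⇒0<n∸m o<n) (m≤n+m (n ∸ o) m)) (≡.sym eq))
  n∣m+[n∸o]⇒m≡o {m} {n} {o} m<n o<n (divides 1 eq) = +-cancelʳ-≡ (n ∸ o) m o (begin
    m + (n ∸ o)  ≡⟨ eq ⟩
    n + 0        ≡⟨ +-identityʳ n ⟩
    n            ≡⟨ m+[n∸m]≡n (<⇒≤ o<n) ⟨
    o + (n ∸ o)  ∎)
  n∣m+[n∸o]⇒m≡o {m} {n} {o} m<n o<n (divides (suc (suc q)) eq) = ⊥-elim (<-irrefl eq
    (<-≤-trans (+-mono-<-≤ m<n (m∸n≤m n o)) (+-monoʳ-≤ n (m≤m+n n (q * n)))))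

  m∣n⇒m∣o⇒n∣n/m*o : ∀ {m n o} .{{_ : NonZero m}} → m ∣ n → m ∣ o → n ∣ n / m * o
  m∣n⇒m∣o⇒n∣n/m*o {m} {n} {o} m∣n m∣o =
    ≡.subst (_∣ n / m * o) (m/n*n≡m m∣n) (*-monoʳ-∣ (n / m) m∣o)

  m∣n*o⇒m/gcd[m,n]∣o : ∀ {m n o} .{{_ : NonZero (gcd m n)}} → m ∣ n * o → m / gcd m n ∣ o
  m∣n*o⇒m/gcd[m,n]∣o {m} {n} {o} m∣n*o = coprime-divisor (coprime-/gcd m n)
    (m∣n*o⇒m/n∣o (gcd[m,n]∣m m n) (≡.subst (m ∣_) n*o≡n′*o*g m∣n*o))
    where
    g = gcd m n
    n*o≡n′*o*g : n * o ≡ n / g * o * g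
    n*o≡n′*o*g = begin
      n * o            ≡⟨ ≡.cong (_* o) (m/n*n≡m (gcd[m,n]∣n m n)) ⟨
      n / g * g * o    ≡⟨ *-assoc (n / g) g o ⟩
      n / g * (g * o)  ≡⟨ ≡.cong (n / g *_) (*-comm g o) ⟩
      n / g * (o * g)  ≡⟨ *-assoc (n / g) o g ⟨
      n / g * o * g    ∎

  ∣*-all⇒/∣ : ∀ {i} {I : Set i} (a : I → ℕ) {n d s} .{{_ : NonZero n}} .{{_ : NonZero d}} →
              d ∣ n → (∀ e → e ∣ n → (∀ x → e ∣ a x) → e ∣ d) →
              (∀ x → n ∣ s * a x) → n / d ∣ s
  ∣*-all⇒/∣ a {n} {d} {s} d∣n greatest n∣s*a =
    m∣n*o⇒m/n∣o d∣n (≡.subst (n ∣_) (*-comm d s) n∣d*s)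
    where
    instance
      gcd≢0 : NonZero (gcd n s)
      gcd≢0 = ≢-nonZero (gcd[m,n]≢0 n s (inj₁ (≢-nonZero⁻¹ n)))
    n/g∣d : n / gcd n s ∣ d
    n/g∣d = greatest _ (m/n∣m (gcd[m,n]∣m n s)) (λ x → m∣n*o⇒m/gcd[m,n]∣o (n∣s*a x))
    n∣d*s : n ∣ d * s
    n∣d*s = ∣-trans (m/n∣o⇒m∣o*n (gcd[m,n]∣m n s) n/g∣d) (*-monoʳ-∣ d (gcd[m,n]∣n n s))

module _ {c ℓ : Level} (R : CommutativeRing c ℓ) where
  open CommutativeRing R
  open import Algebra.Properties.Semiring.Sum semiring
  open import Algebra.Properties.Semiring.Exp semiring
  open import Algebra.Properties.CommutativeSemiring.Exp commutativeSemiring using (^-distrib-*)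
  open import Algebra.Properties.CommutativeSemigroup *-commutativeSemigroup
    using (x∙yz≈xz∙y; x∙yz≈y∙zx)
  open import Algebra.Properties.Group +-group using (∙-cancelʳ)
  open import Data.Maybe using (nothing)
  open import Tactic.RingSolver.Core.AlmostCommutativeRing using (fromCommutativeRing)
  open import Tactic.RingSolver.NonReflective (fromCommutativeRing R (λ _ → nothing))
    using (solve; _⊜_; _⊕_; _⊗_)
  open import Relation.Binary.Reasoning.Setoid setoid
  import Data.Nat as ℕ
  import Data.Fin as Fin
  open import Data.Fin using (punchIn)
  open import Data.Fin.Properties using (punchInᵢ≢i)
  open ≡ using (_≢_)
  open IsFiniteFieldOfOrder using (enum-surj; enum-inj)

  sumFin≡sum : ∀ {n} (g : Fin n → Carrier) → sumFin R g ≡ sum g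
  sumFin≡sum {zero} g = ≡.refl
  sumFin≡sum {suc n} g = ≡.cong (g Fin.zero +_) (sumFin≡sum (g ∘ Fin.suc))

  pow≡^ : ∀ x n → pow R x n ≡ x ^ n
  pow≡^ x zero = ≡.refl
  pow≡^ x (suc n) = ≡.cong (x *_) (pow≡^ x n)

  DFT≡∑ : ∀ {N} x (f : Fin N → Carrier) i →
          DFT R x f i ≡ ∑[ j < N ] (f j * x ^ (toℕ i ℕ.* toℕ j))
  DFT≡∑ {N} x f i = ≡.trans (sumFin≡sum {N} _)
    (sum-cong-≗ (λ j → ≡.cong (f j *_) (pow≡^ x (toℕ i ℕ.* toℕ j))))

  DFT-cong : ∀ {N} x {f g : Fin N → Carrier} → (∀ j → f j ≈ g j) →
             ∀ i → DFT R x f i ≈ DFT R x g i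
  DFT-cong x {f} {g} f≈g i = begin
    DFT R x f i                                ≡⟨ DFT≡∑ x f i ⟩
    ∑[ j < _ ] (f j * x ^ (toℕ i ℕ.* toℕ j))  ≈⟨ sum-cong-≋ (λ j → *-congʳ (f≈g j)) ⟩
    ∑[ j < _ ] (g j * x ^ (toℕ i ℕ.* toℕ j))  ≡⟨ DFT≡∑ x g i ⟨
    DFT R x g i                                ∎

  sum-1#≈embed : ∀ n → ∑[ i < n ] 1# ≈ embed R n
  sum-1#≈embed zero = refl
  sum-1#≈embed (suc n) = +-congˡ (sum-1#≈embed n)

  sum-supported-at : ∀ {n} (g : Fin n → Carrier) k → (∀ j → j ≢ k → g j ≈ 0#) → sum g ≈ g k
  sum-supported-at {suc n} g k vanish = begin
    sum g                          ≈⟨ sum-remove {i = k} g ⟩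
    g k + sum (g ∘ punchIn k)      ≈⟨ +-congˡ (sum-cong-≋ (λ j → vanish _ (punchInᵢ≢i k j))) ⟩
    g k + ∑[ j < n ] 0#            ≈⟨ +-congˡ (sum-replicate-zero n) ⟩
    g k + 0#                       ≈⟨ +-identityʳ (g k) ⟩
    g k                            ∎

  ^-zeroˡ : ∀ n → 1# ^ n ≈ 1#
  ^-zeroˡ zero = refl
  ^-zeroˡ (suc n) = trans (*-identityˡ _) (^-zeroˡ n)

  geometric-sum : ∀ x n → x * ∑[ i < n ] (x ^ toℕ i) + 1# ≈ ∑[ i < n ] (x ^ toℕ i) + x ^ n
  geometric-sum x zero = trans (+-congʳ (zeroʳ x)) (trans (+-identityˡ 1#) (sym (+-identityˡ 1#)))
  geometric-sum x (suc n) = begin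
    x * (1# + ∑[ i < n ] (x * x ^ toℕ i)) + 1#     ≈⟨ +-congʳ (*-congˡ (+-congˡ xS≈∑)) ⟨
    x * (1# + x * S) + 1#
      ≈⟨ solve 3 (λ x S o → (x ⊗ (o ⊕ x ⊗ S) ⊕ o) ⊜ (x ⊗ (x ⊗ S ⊕ o) ⊕ o)) refl x S 1# ⟩
    x * (x * S + 1#) + 1#                          ≈⟨ +-congʳ (*-congˡ (geometric-sum x n)) ⟩
    x * (S + x ^ n) + 1#
      ≈⟨ solve 4 (λ x S p o → (x ⊗ (S ⊕ p) ⊕ o) ⊜ ((o ⊕ x ⊗ S) ⊕ x ⊗ p)) refl x S (x ^ n) 1# ⟩
    (1# + x * S) + x * x ^ n                       ≈⟨ +-congʳ (+-congˡ xS≈∑) ⟩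
    (1# + ∑[ i < n ] (x * x ^ toℕ i)) + x * x ^ n  ∎
    where
    S = ∑[ i < n ] (x ^ toℕ i)
    xS≈∑ : x * S ≈ ∑[ i < n ] (x * x ^ toℕ i)
    xS≈∑ = *-distribˡ-sum {n} x (λ i → x ^ toℕ i)

  *-cancelˡ-unit : ∀ {u v x y} → v * u ≈ 1# → u * x ≈ u * y → x ≈ y
  *-cancelˡ-unit {u} {v} {x} {y} vu≈1 ux≈uy = begin
    x            ≈⟨ *-identityˡ x ⟨
    1# * x       ≈⟨ *-congʳ vu≈1 ⟨
    v * u * x    ≈⟨ *-assoc v u x ⟩
    v * (u * x)  ≈⟨ *-congˡ ux≈uy ⟩
    v * (u * y)  ≈⟨ *-assoc v u y ⟨
    v * u * y    ≈⟨ *-congʳ vu≈1 ⟩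
    1# * y       ≈⟨ *-identityˡ y ⟩
    y            ∎

  unit≉0 : ∀ {x y} → ¬ 0# ≈ 1# → x * y ≈ 1# → ¬ x ≈ 0#
  unit≉0 {x} {y} 0≉1 xy≈1 x≈0 = 0≉1 (trans (sym (zeroˡ y)) (trans (*-congʳ (sym x≈0)) xy≈1))

  IsLeastPeriod-*ˡ : ∀ {N} .{{_ : NonZero N}} {g r u v} →
                     v * u ≈ 1# → IsLeastPeriod R N g r → IsLeastPeriod R N (λ i → u * g i) r
  IsLeastPeriod-*ˡ vu≈1 (r>0 , per , least) =
      r>0
    , (λ i → *-congˡ (per i))
    , λ s s>0 per′ → least s s>0 (λ i → *-cancelˡ-unit vu≈1 (per′ i))

  IsPrimitiveRoot-inverse : ∀ {N ζ ζ′} → ζ * ζ′ ≈ 1# →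
                            IsPrimitiveRoot R N ζ → IsPrimitiveRoot R N ζ′
  IsPrimitiveRoot-inverse {N} {ζ} {ζ′} ζζ′≈1 (ζ^N≈1 , ζ^k≉1) =
      trans (sym (*-identityˡ _)) (trans (*-congʳ (sym ζ^N≈1)) (ζ^kζ′^k≈1 N))
    , λ k k>0 k<N ζ′^k≈1 → ζ^k≉1 k k>0 k<N
        (trans (sym (*-identityʳ _)) (trans (*-congˡ (sym ζ′^k≈1)) (ζ^kζ′^k≈1 k)))
    where
    ζ^kζ′^k≈1 : ∀ k → pow R ζ k * pow R ζ′ k ≈ 1#
    ζ^kζ′^k≈1 k = begin
      pow R ζ k * pow R ζ′ k  ≡⟨ ≡.cong₂ _*_ (pow≡^ ζ k) (pow≡^ ζ′ k) ⟩
      ζ ^ k * ζ′ ^ k          ≈⟨ ^-distrib-* ζ ζ′ k ⟨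
      (ζ * ζ′) ^ k            ≈⟨ ^-congˡ k ζζ′≈1 ⟩
      1# ^ k                  ≈⟨ ^-zeroˡ k ⟩
      1#                      ∎

  ≈-decidable : ∀ {q} → IsFiniteFieldOfOrder R q → Decidable _≈_
  ≈-decidable ff x y with enum-surj ff x | enum-surj ff y
  ... | a , ea | b , eb = map′ (λ { ≡.refl → trans (sym ea) eb })
                               (λ x≈y → enum-inj ff a b (trans ea (trans x≈y (sym eb))))
                               (a Fin.≟ b)

  module PrimitiveRoot {N : ℕ} .{{_ : NonZero N}} {ζ : Carrier} (prim : IsPrimitiveRoot R N ζ)
    where
    open import Data.Nat.DivMod using (m≡m%n+[m/n]*n; m%n<n)
    open import Data.Nat.Divisibility using (m%n≡0⇒n∣m; n∣m⇒m%n≡0)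
    import Data.Nat.Properties as ℕₚ
    open import Data.Fin.Properties using (toℕ-fromℕ<)

    ζ^N≈1 : ζ ^ N ≈ 1#
    ζ^N≈1 = trans (reflexive (≡.sym (pow≡^ ζ N))) (proj₁ prim)

    ζ^m≈ζ^[m%N] : ∀ m → ζ ^ m ≈ ζ ^ (m % N)
    ζ^m≈ζ^[m%N] m = begin
      ζ ^ m                               ≡⟨ ≡.cong (ζ ^_) (m≡m%n+[m/n]*n m N) ⟩
      ζ ^ (m % N ℕ.+ m / N ℕ.* N)         ≈⟨ ^-homo-* ζ (m % N) (m / N ℕ.* N) ⟩
      ζ ^ (m % N) * ζ ^ (m / N ℕ.* N)     ≈⟨ *-congˡ (^-congʳ ζ (ℕₚ.*-comm (m / N) N)) ⟩
      ζ ^ (m % N) * ζ ^ (N ℕ.* (m / N))   ≈⟨ *-congˡ (^-assocʳ ζ N (m / N)) ⟨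
      ζ ^ (m % N) * (ζ ^ N) ^ (m / N)     ≈⟨ *-congˡ (^-congˡ (m / N) ζ^N≈1) ⟩
      ζ ^ (m % N) * 1# ^ (m / N)          ≈⟨ *-congˡ (^-zeroˡ (m / N)) ⟩
      ζ ^ (m % N) * 1#                    ≈⟨ *-identityʳ _ ⟩
      ζ ^ (m % N)                         ∎

    ζ^[m%N*n]≈ζ^[m*n] : ∀ m n → ζ ^ (m % N ℕ.* n) ≈ ζ ^ (m ℕ.* n)
    ζ^[m%N*n]≈ζ^[m*n] m n = begin
      ζ ^ (m % N ℕ.* n)   ≈⟨ ^-assocʳ ζ (m % N) n ⟨
      (ζ ^ (m % N)) ^ n   ≈⟨ ^-congˡ n (ζ^m≈ζ^[m%N] m) ⟨
      (ζ ^ m) ^ n         ≈⟨ ^-assocʳ ζ m n ⟩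
      ζ ^ (m ℕ.* n)       ∎

    ∣⇒ζ^≈1 : ∀ {m} → N ∣ m → ζ ^ m ≈ 1#
    ∣⇒ζ^≈1 {m} N∣m =
      trans (ζ^m≈ζ^[m%N] m) (reflexive (≡.cong (ζ ^_) (n∣m⇒m%n≡0 m N N∣m)))

    ζ^≈1⇒∣ : ∀ {m} → ζ ^ m ≈ 1# → N ∣ m
    ζ^≈1⇒∣ {m} ζ^m≈1 with m % N in m%N≡
    ... | zero  = m%n≡0⇒n∣m m N m%N≡
    ... | suc r =
      ⊥-elim (proj₂ prim (suc r) z<s (≡.subst (_< N) m%N≡ (m%n<n m N)) ζ^[1+r]≈1)
      where
      ζ^[1+r]≈1 : pow R ζ (suc r) ≈ 1#
      ζ^[1+r]≈1 = begin
        pow R ζ (suc r)  ≡⟨ ≡.trans (pow≡^ ζ (suc r)) (≡.cong (ζ ^_) (≡.sym m%N≡)) ⟩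
        ζ ^ (m % N)      ≈⟨ ζ^m≈ζ^[m%N] m ⟨
        ζ ^ m            ≈⟨ ζ^m≈1 ⟩
        1#               ∎

    modulate : ℕ → (Fin N → Carrier) → Fin N → Carrier
    modulate r f j = f j * ζ ^ (r ℕ.* toℕ j)

    DFT-shift : ∀ f r i → DFT R ζ f ((toℕ i ℕ.+ r) mod N) ≈ DFT R ζ (modulate r f) i
    DFT-shift f r i = begin
      DFT R ζ f (a mod N)                                  ≡⟨ DFT≡∑ ζ f (a mod N) ⟩
      ∑[ j < N ] (f j * ζ ^ (toℕ (a mod N) ℕ.* toℕ j))     ≈⟨ sum-cong-≋ shifted ⟩
      ∑[ j < N ] (modulate r f j * ζ ^ (toℕ i ℕ.* toℕ j))  ≡⟨ DFT≡∑ ζ (modulate r f) i ⟨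
      DFT R ζ (modulate r f) i                             ∎
      where
      a = toℕ i ℕ.+ r
      shifted : ∀ j → f j * ζ ^ (toℕ (a mod N) ℕ.* toℕ j) ≈
                      modulate r f j * ζ ^ (toℕ i ℕ.* toℕ j)
      shifted j = begin
        f j * ζ ^ (toℕ (a mod N) ℕ.* toℕ j)
          ≡⟨ ≡.cong (λ e → f j * ζ ^ (e ℕ.* toℕ j)) (toℕ-fromℕ< (m%n<n a N)) ⟩
        f j * ζ ^ (a % N ℕ.* toℕ j)
          ≈⟨ *-congˡ (ζ^[m%N*n]≈ζ^[m*n] a (toℕ j)) ⟩
        f j * ζ ^ (a ℕ.* toℕ j)
          ≡⟨ ≡.cong (λ e → f j * ζ ^ e) (ℕₚ.*-distribʳ-+ (toℕ j) (toℕ i) r) ⟩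
        f j * ζ ^ (toℕ i ℕ.* toℕ j ℕ.+ r ℕ.* toℕ j)
          ≈⟨ *-congˡ (^-homo-* ζ (toℕ i ℕ.* toℕ j) (r ℕ.* toℕ j)) ⟩
        f j * (ζ ^ (toℕ i ℕ.* toℕ j) * ζ ^ (r ℕ.* toℕ j))
          ≈⟨ x∙yz≈xz∙y _ _ _ ⟩
        f j * ζ ^ (r ℕ.* toℕ j) * ζ ^ (toℕ i ℕ.* toℕ j)
          ∎

  AnnihilatesSupp : ∀ {N} → ℕ → (Fin N → Carrier) → Set ℓ
  AnnihilatesSupp {N} r f = ∀ j → ¬ f j ≈ 0# → N ∣ r ℕ.* toℕ j

  module _ (inverse : ∀ x → ¬ x ≈ 0# → ∃ λ y → x * y ≈ 1#) where

    *-cancelˡ-≉0 : ∀ {x y z} → ¬ x ≈ 0# → x * y ≈ x * z → y ≈ z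
    *-cancelˡ-≉0 {x} x≉0 with inverse x x≉0
    ... | x⁻¹ , xx⁻¹≈1 = *-cancelˡ-unit (trans (*-comm x⁻¹ x) xx⁻¹≈1)

    module _ (_≈?_ : Decidable _≈_) {N : ℕ} .{{_ : NonZero N}} {ζ : Carrier}
             (prim : IsPrimitiveRoot R N ζ) (N≉0 : ¬ embed R N ≈ 0#) where
      open PrimitiveRoot prim
      open import Data.Nat.Divisibility using (n∣m*n; ∣n⇒∣m*n)
      import Data.Nat.Properties as ℕₚ
      open import Data.Fin.Properties using (toℕ<n; toℕ-injective)

      χ : Fin N → ℕ → Carrier
      χ i m = ζ ^ (toℕ i ℕ.* m)

      ∑χ≈0 : ∀ {m} → ¬ N ∣ m → ∑[ i < N ] χ i m ≈ 0#
      ∑χ≈0 {m} N∤m = trans (sum-cong-≋ {N} χim≈x^i) S≈0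
        where
        x = ζ ^ m
        S = ∑[ i < N ] (x ^ toℕ i)
        χim≈x^i : ∀ i → χ i m ≈ x ^ toℕ i
        χim≈x^i i = trans (^-congʳ ζ (ℕₚ.*-comm (toℕ i) m)) (sym (^-assocʳ ζ m (toℕ i)))
        xS≈S : x * S ≈ S
        xS≈S = ∙-cancelʳ 1# (x * S) S (trans (geometric-sum x N)
                 (+-congˡ (trans (^-assocʳ ζ m N) (∣⇒ζ^≈1 (n∣m*n m)))))
        S≈0 : S ≈ 0#
        S≈0 with S ≈? 0#
        ... | yes S≈0 = S≈0
        ... | no S≉0  = ⊥-elim (N∤m (ζ^≈1⇒∣ (*-cancelˡ-≉0 S≉0
                          (trans (*-comm S x) (trans xS≈S (sym (*-identityʳ S)))))))

      ∑χ≈N : ∀ {m} → N ∣ m → ∑[ i < N ] χ i m ≈ embed R N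
      ∑χ≈N N∣m = trans (sum-cong-≋ {N} (λ i → ∣⇒ζ^≈1 (∣n⇒∣m*n (toℕ i) N∣m))) (sum-1#≈embed N)

      -- N ∸ toℕ k represents -k in ℤ_N.
      DFT-inversion : ∀ g k → ∑[ i < N ] (χ i (N ∸ toℕ k) * DFT R ζ g i) ≈ embed R N * g k
      DFT-inversion g k = begin
        ∑[ i < N ] (χ i k̄ * DFT R ζ g i)
          ≡⟨ sum-cong-≗ (λ i → ≡.cong (χ i k̄ *_) (DFT≡∑ ζ g i)) ⟩
        ∑[ i < N ] (χ i k̄ * ∑[ j < N ] (g j * χ i (toℕ j)))
          ≈⟨ sum-cong-≋ {N} (λ i → *-distribˡ-sum {N} (χ i k̄) (λ j → g j * χ i (toℕ j))) ⟩
        ∑[ i < N ] ∑[ j < N ] (χ i k̄ * (g j * χ i (toℕ j)))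
          ≈⟨ sum-cong-≋ {N} (λ i → sum-cong-≋ {N} (combine i)) ⟩
        ∑[ i < N ] ∑[ j < N ] (g j * χ i (toℕ j ℕ.+ k̄))
          ≈⟨ ∑-comm {N} {N} _ ⟩
        ∑[ j < N ] ∑[ i < N ] (g j * χ i (toℕ j ℕ.+ k̄))
          ≈⟨ sum-cong-≋ {N} (λ j → *-distribˡ-sum {N} (g j) (λ i → χ i (toℕ j ℕ.+ k̄))) ⟨
        ∑[ j < N ] (g j * ∑[ i < N ] χ i (toℕ j ℕ.+ k̄))
          ≈⟨ sum-supported-at _ k off-diagonal ⟩
        g k * ∑[ i < N ] χ i (toℕ k ℕ.+ k̄)
          ≈⟨ *-congˡ (∑χ≈N N∣k+k̄) ⟩
        g k * embed R N
          ≈⟨ *-comm (g k) _ ⟩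
        embed R N * g k
          ∎
        where
        k̄ = N ∸ toℕ k
        combine : ∀ i j → χ i k̄ * (g j * χ i (toℕ j)) ≈ g j * χ i (toℕ j ℕ.+ k̄)
        combine i j = begin
          χ i k̄ * (g j * χ i (toℕ j))                  ≈⟨ x∙yz≈y∙zx _ _ _ ⟩
          g j * (χ i (toℕ j) * χ i k̄)                  ≈⟨ *-congˡ (^-homo-* ζ (toℕ i ℕ.* toℕ j) _) ⟨
          g j * ζ ^ (toℕ i ℕ.* toℕ j ℕ.+ toℕ i ℕ.* k̄)  ≈⟨ *-congˡ (^-congʳ ζ (ℕₚ.*-distribˡ-+ (toℕ i) (toℕ j) k̄)) ⟨
          g j * χ i (toℕ j ℕ.+ k̄)                      ∎
        off-diagonal : ∀ j → j ≢ k → g j * ∑[ i < N ] χ i (toℕ j ℕ.+ k̄) ≈ 0#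
        off-diagonal j j≢k = trans (*-congˡ (∑χ≈0 λ N∣j+k̄ →
          j≢k (toℕ-injective (n∣m+[n∸o]⇒m≡o (toℕ<n j) (toℕ<n k) N∣j+k̄)))) (zeroʳ (g j))
        N∣k+k̄ : N ∣ toℕ k ℕ.+ k̄
        N∣k+k̄ = ≡.subst (N ∣_) (≡.sym (ℕₚ.m+[n∸m]≡n (ℕₚ.<⇒≤ (toℕ<n k)))) ∣-refl

      DFT-injective : ∀ {g h} → (∀ i → DFT R ζ g i ≈ DFT R ζ h i) → ∀ k → g k ≈ h k
      DFT-injective {g} {h} Fg≈Fh k = *-cancelˡ-≉0 N≉0 (begin
        embed R N * g k                              ≈⟨ DFT-inversion g k ⟨
        ∑[ i < N ] (χ i (N ∸ toℕ k) * DFT R ζ g i)  ≈⟨ sum-cong-≋ {N} (λ i → *-congˡ (Fg≈Fh i)) ⟩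
        ∑[ i < N ] (χ i (N ∸ toℕ k) * DFT R ζ h i)  ≈⟨ DFT-inversion h k ⟩
        embed R N * h k                              ∎)

      IsPeriod-DFT⇔ : ∀ f r → IsPeriod R N (DFT R ζ f) r ⇔ AnnihilatesSupp r f
      IsPeriod-DFT⇔ f r = mk⇔ to from
        where
        to : IsPeriod R N (DFT R ζ f) r → AnnihilatesSupp r f
        to per j fj≉0 =
          ζ^≈1⇒∣ (*-cancelˡ-≉0 fj≉0 (trans (modulated≈f j) (sym (*-identityʳ (f j)))))
          where
          modulated≈f : ∀ j → modulate r f j ≈ f j
          modulated≈f = DFT-injective (λ i → trans (sym (DFT-shift f r i)) (per i))
        from : AnnihilatesSupp r f → IsPeriod R N (DFT R ζ f) r
        from N∣rj i = trans (DFT-shift f r i) (DFT-cong ζ modulated≈f i)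
          where
          modulated≈f : ∀ j → modulate r f j ≈ f j
          modulated≈f j with f j ≈? 0#
          ... | yes fj≈0 = trans (*-congʳ fj≈0) (trans (zeroˡ _) (sym fj≈0))
          ... | no fj≉0  = trans (*-congˡ (∣⇒ζ^≈1 (N∣rj j fj≉0))) (*-identityʳ (f j))

      DFT-leastPeriod : ∀ f {d} .{{_ : NonZero d}} → IsGcdSupp R N f d →
                        IsLeastPeriod R N (DFT R ζ f) (N / d)
      DFT-leastPeriod f {d} (d∣N , d∣supp , greatest) =
          m≥n⇒m/n>0 (∣⇒≤ d∣N)
        , Equivalence.from (IsPeriod-DFT⇔ f (N / d))
            (λ j fj≉0 → m∣n⇒m∣o⇒n∣n/m*o d∣N (d∣supp j fj≉0))
        , λ s s>0 per → ∣⇒≤ {{>-nonZero s>0}} (∣*-all⇒/∣ (toℕ ∘ proj₁) d∣N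
            (λ e e∣N e∣supp → greatest e e∣N (curry e∣supp))
            (uncurry (Equivalence.to (IsPeriod-DFT⇔ f s) per)))

proposition3p1 : ∀ {c ℓ : Level} (R : CommutativeRing c ℓ) (q : ℕ) →
    IsPrimePower q → IsFiniteFieldOfOrder R q →
    (N : ℕ) .{{_ : NonZero N}} → N ∣ q ∸ 1 →
    (f : Fin N → CommutativeRing.Carrier R) →
    (ζ : CommutativeRing.Carrier R) → IsPrimitiveRoot R N ζ →
    (Ninv ζinv : CommutativeRing.Carrier R) →
    CommutativeRing._≈_ R (CommutativeRing._*_ R (embed R N) Ninv) (CommutativeRing.1# R) →
    CommutativeRing._≈_ R (CommutativeRing._*_ R ζ ζinv) (CommutativeRing.1# R) →
    (d : ℕ) .{{_ : NonZero d}} → IsGcdSupp R N f d →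
    IsLeastPeriod R N (DFT R ζ f) (N / d) ×
    IsLeastPeriod R N (invDFT R Ninv ζinv f) (N / d)
proposition3p1 R q _ finite N _ f ζ prim Ninv ζinv N*Ninv≈1 ζ*ζinv≈1 d gcd =
    leastPeriod prim
  , IsLeastPeriod-*ˡ R N*Ninv≈1 (leastPeriod (IsPrimitiveRoot-inverse R ζ*ζinv≈1 prim))
  where
  open IsFiniteFieldOfOrder finite using (0≉1; inverse)
  leastPeriod : ∀ {ζ} → IsPrimitiveRoot R N ζ → IsLeastPeriod R N (DFT R ζ f) (N / d)
  leastPeriod prim =
    DFT-leastPeriod R inverse (≈-decidable R finite) prim (unit≉0 R 0≉1 N*Ninv≈1) f gcd
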